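{- Let $\alpha$ be a snowy weak composition, take $n$ with $\mathsf{supp}(\alpha)\subseteq[n]$ and $m$ with $\max(\alpha)\le m$, and let $w=\mathsf{std}_{m,n}(\alpha)$. Then both the underlying diagram of $\mathsf{snow}(D(\alpha))$ and $RD(w)$ are contained in $[n]\times[m]$, and $$\mathsf{snow}(D(\alpha))=\{(r,c)\in[n]\times[m]:(n+1-r,\,m+1-c)\notin RD(w)\}$$ (ignoring labels); i.e., rotating $RD(w)$ by $180^\circ$ inside the $n\times m$ box and taking the complement in that box gives $\mathsf{snow}(D(\alpha))$ without labels.
   Context: A diagram is a finite subset of $\mathbb{N}\times\mathbb{N}$, a cell $(r,c)$ being in row $r$ (rows numbered from the top) and column $c$. A weak composition is a sequence of non-negative integers with finitely many positive entries; $\mathsf{supp}(\alpha)=\{i:\alpha_i>0\}$; $\alpha$ is snowy if its positive entries are distinct. $D(\alpha)=\{(r,c):1\le c\le\alpha_r\}$. For snowy $\alpha$, the snow diagram $\mathsf{snow}(D(\alpha))$ is obtained from $D(\alpha)$ by labeling the rightmost cell of each nonempty row with $\bullet$ and then adding a cell labeled $\ast$ in every empty position directly above (same column, smaller row) each $\bullet$; its underlying set is $\{(r,c):c\le\alpha_r\text{ or }c=\alpha_j\text{ for some }j>r\text{ with }\alpha_j>0\}$. For a permutation $w$, the Rothe diagram is $RD(w)=\{(r,c):w(r)>c,\ w(i)\ne c\text{ for all }i\in[r]\}$. For $\alpha$ with $\mathsf{supp}(\alpha)\subseteq[n]$, $r_{m+1,n}(\alpha)=(m+1-\alpha_n,\dots,m+1-\alpha_1)$.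 Standardization: with $\beta=r_{m+1,n}(\alpha)$, $\mathsf{std}_{m,n}(\alpha)$ is the unique permutation $w$ of $\{1,2,\dots\}$ (fixing all but finitely many elements) with $w(n+1)<w(n+2)<\cdots$ and, for $i\in[n]$, $w(i)=\beta_i$ if $\beta_i\le m$, and $w(i)=m+|\{j\in[i]:\beta_j=m+1\}|$ if $\beta_i=m+1$. -}

module Defs where

open import Data.Nat using (ℕ; zero; suc; _+_; _∸_; _≤_; _<_)
open import Data.Nat.Properties using (_≟_)
open import Data.Product using (_×_; Σ; ∃; ∃-syntax)
open import Data.Sum using (_⊎_)
open import Relation.Nullary using (¬_; yes; no)
open import Relation.Binary.PropositionalEquality using (_≡_)

-- Conventions: positive integers are ℕ-values ≥ 1; index 0 is ignored everywhere.
-- A weak composition α = (α₁, α₂, …) is a function ℕ → ℕ, α i = αᵢ for i ≥ 1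
-- (the value at 0 is junk and never used).
WeakComp : Set
WeakComp = ℕ → ℕ

Diagram : Set₁
Diagram = ℕ → ℕ → Set

SuppIn : WeakComp → ℕ → Set
SuppIn α n = ∀ i → 1 ≤ i → 0 < α i → i ≤ n

MaxLe : WeakComp → ℕ → Set
MaxLe α m = ∀ i → 1 ≤ i → α i ≤ m

Snowy : WeakComp → Set
Snowy α = ∀ i j → 1 ≤ i → 1 ≤ j → 0 < α i → α i ≡ α j → i ≡ j

D : WeakComp → Diagram
D α r c = 1 ≤ r × 1 ≤ c × c ≤ α r

-- underlying set of snow(D(α)):
-- {(r,c) : c ≤ α_r, or c = α_j for some j > r with α_j > 0}
snow : WeakComp → Diagram
snow α r c = 1 ≤ r × (D α r c ⊎ (∃[ j ] (r < j × 0 < α j × c ≡ α j)))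

Box : ℕ → ℕ → Diagram
Box n m r c = (1 ≤ r × r ≤ n) × (1 ≤ c × c ≤ m)

RD : (ℕ → ℕ) → Diagram
RD w r c = 1 ≤ r × 1 ≤ c × c < w r × (∀ i → 1 ≤ i → i ≤ r → ¬ (w i ≡ c))

IsPerm : (ℕ → ℕ) → Set
IsPerm w =
  (∀ i → 1 ≤ i → 1 ≤ w i) ×
  (∀ i j → 1 ≤ i → 1 ≤ j → w i ≡ w j → i ≡ j) ×
  (∀ k → 1 ≤ k → ∃[ i ] (1 ≤ i × w i ≡ k)) ×
  (∃[ N ] (∀ i → N < i → w i ≡ i))

rev : ℕ → ℕ → WeakComp → ℕ → ℕ
rev m n α i = suc m ∸ α (suc n ∸ i)

countTop : ℕ → (ℕ → ℕ) → ℕ → ℕ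
countTop m β zero = 0
countTop m β (suc i) with β (suc i) ≟ suc m
... | yes _ = suc (countTop m β i)
... | no _  = countTop m β i

IsStd : ℕ → ℕ → WeakComp → (ℕ → ℕ) → Set
IsStd m n α w =
  IsPerm w ×
  (∀ i → n < i → w i < w (suc i)) ×
  (∀ i → 1 ≤ i → i ≤ n →
     (rev m n α i ≤ m → w i ≡ rev m n α i) ×
     (rev m n α i ≡ suc m → w i ≡ m + countTop m (rev m n α) i))

-- Write r' = n+1-r, c' = m+1-c and β = r_{m+1,n}(α), so that w(i) = β_i = m+1-α_{n+1-i}
-- whenever α_{n+1-i} > 0, while rows with α_{n+1-i} = 0 receive the values m+1, m+2, ….
-- For (r,c) in the box, the two conditions defining (r',c') ∈ RD(w) then read
--   c' < w(r')                       ⟺  α_r < c,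
--   c' ∉ {w(1), …, w(r')}            ⟺  c ∉ {α_r, α_{r+1}, …},
-- so (r',c') ∈ RD(w) iff c > α_r and c is not the length of any lower row, which is exactly
-- the complement of snow(D(α)).  Containment in the box comes from the facts that the
-- values of w above m are used in order and that w is increasing beyond n.
module Submission where

open import Defs
open import Data.Nat using (ℕ; zero; suc; _∸_; _+_; _≤_; _<_; z≤n; s≤s; _≤?_; _<?_)
open import Data.Nat.Properties
open import Data.Product using (_×_; _,_; proj₁; proj₂; ∃-syntax)
open import Data.Sum using (_⊎_; inj₁; inj₂)
open import Data.Empty using (⊥-elim)
open import Relation.Nullary using (¬_; yes; no)
open import Relation.Nullary.Decidable using (_×-dec_)
open import Relation.Binary.PropositionalEquality
open import Function.Bundles using (_⇔_; mk⇔; module Equivalence)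

OccursUpTo : (ℕ → ℕ) → ℕ → ℕ → Set
OccursUpTo f r c = ∃[ i ] (1 ≤ i × i ≤ r × f i ≡ c)

OccursFrom : (ℕ → ℕ) → ℕ → ℕ → Set
OccursFrom f r c = ∃[ j ] (r ≤ j × f j ≡ c)

RD⇒¬OccursUpTo : ∀ {w r c} → RD w r c → ¬ OccursUpTo w r c
RD⇒¬OccursUpTo (_ , _ , _ , avoids) (i , 1≤i , i≤r , wi≡c) = avoids i 1≤i i≤r wi≡c

countTop-suc-top : ∀ m (β : ℕ → ℕ) r → β (suc r) ≡ suc m →
  countTop m β (suc r) ≡ suc (countTop m β r)
countTop-suc-top m β r βr≡ with β (suc r) ≟ suc m
... | yes _ = refl
... | no βr≢ = ⊥-elim (βr≢ βr≡)

countTop-positive : ∀ m (β : ℕ → ℕ) i → 1 ≤ i → β i ≡ suc m → 1 ≤ countTop m β i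
countTop-positive m β (suc i) _ βi≡ rewrite countTop-suc-top m β i βi≡ = s≤s z≤n

-- countTop grows by steps of one, each step at an index where β takes the value m+1.
countTop-attains : ∀ m (β : ℕ → ℕ) r t → 1 ≤ t → t ≤ countTop m β r →
  ∃[ i ] (1 ≤ i × i ≤ r × β i ≡ suc m × countTop m β i ≡ t)
countTop-attains m β zero t 1≤t t≤0 = ⊥-elim (≤⇒≯ t≤0 1≤t)
countTop-attains m β (suc r) t 1≤t t≤ct with β (suc r) ≟ suc m
... | no _ = widen (countTop-attains m β r t 1≤t t≤ct)
  where
  widen : ∀ {P : ℕ → Set} →
    ∃[ i ] (1 ≤ i × i ≤ r × P i) → ∃[ i ] (1 ≤ i × i ≤ suc r × P i)
  widen (i , 1≤i , i≤r , Pi) = i , 1≤i , m≤n⇒m≤1+n i≤r , Pi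
... | yes βr≡ with m≤n⇒m<n∨m≡n t≤ct
...   | inj₂ refl = suc r , s≤s z≤n , ≤-refl , βr≡ , countTop-suc-top m β r βr≡
...   | inj₁ t<ct with countTop-attains m β r t 1≤t (≤-pred t<ct)
...     | i , 1≤i , i≤r , βi≡ , cti≡t = i , 1≤i , m≤n⇒m≤1+n i≤r , βi≡ , cti≡t

reflect-positive : ∀ {n i} → i ≤ n → 1 ≤ suc n ∸ i
reflect-positive i≤n = m<n⇒0<n∸m (s≤s i≤n)

reflect-≤ : ∀ {n i} → 1 ≤ i → suc n ∸ i ≤ n
reflect-≤ {n} 1≤i = ∸-monoʳ-≤ (suc n) 1≤i

reflect-involutive : ∀ {n i} → i ≤ n → suc n ∸ (suc n ∸ i) ≡ i
reflect-involutive i≤n = m∸[m∸n]≡n (m≤n⇒m≤1+n i≤n)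

reflect-antitone : ∀ {n r i} → r ≤ n → i ≤ suc n ∸ r → r ≤ suc n ∸ i
reflect-antitone {n} {r} {i} r≤n i≤r' =
  subst (_≤ suc n ∸ i) (reflect-involutive r≤n) (∸-monoʳ-≤ (suc n) i≤r')

k∸c<k∸a⇔a<c : ∀ {k a c} → c ≤ k → (k ∸ c < k ∸ a ⇔ a < c)
k∸c<k∸a⇔a<c c≤k = mk⇔ ∸-cancelʳ-< (λ a<c → ∸-monoʳ-< a<c c≤k)

module Standardization (α : WeakComp) (n m : ℕ) (w : ℕ → ℕ)
  (supp : SuppIn α n) (max : MaxLe α m) (std : IsStd m n α w) where

  β : ℕ → ℕ
  β = rev m n α

  β-reflect : ∀ {r} → r ≤ n → β (suc n ∸ r) ≡ suc m ∸ α r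
  β-reflect r≤n = cong (λ j → suc m ∸ α j) (reflect-involutive r≤n)

  w-surjective : ∀ k → 1 ≤ k → ∃[ i ] (1 ≤ i × w i ≡ k)
  w-surjective = proj₁ (proj₂ (proj₂ (proj₁ std)))

  w-increasing : ∀ {r i} → n < r → r < i → w r < w i
  w-increasing {r} {suc i} n<r (s≤s r≤i) with m≤n⇒m<n∨m≡n r≤i
  ... | inj₁ r<i = <-trans (w-increasing n<r r<i) (proj₁ (proj₂ std) i (<-trans n<r r<i))
  ... | inj₂ refl = proj₁ (proj₂ std) r n<r

  w-low : ∀ k → 1 ≤ k → k ≤ n → β k ≤ m → w k ≡ β k
  w-low k 1≤k k≤n = proj₁ (proj₂ (proj₂ std) k 1≤k k≤n)

  w-top : ∀ k → 1 ≤ k → k ≤ n → β k ≡ suc m → w k ≡ m + countTop m β k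
  w-top k 1≤k k≤n = proj₂ (proj₂ (proj₂ std) k 1≤k k≤n)

  w-row : ∀ k → 1 ≤ k → k ≤ n →
    (β k ≡ suc m × suc m ≤ w k) ⊎ (β k ≤ m × w k ≡ β k)
  w-row k 1≤k k≤n with m≤n⇒m<n∨m≡n (m∸n≤m (suc m) (α (suc n ∸ k)))
  ... | inj₁ βk<1+m = inj₂ (≤-pred βk<1+m , w-low k 1≤k k≤n (≤-pred βk<1+m))
  ... | inj₂ βk≡ = inj₁ (βk≡ , subst (suc m ≤_) (sym (w-top k 1≤k k≤n βk≡))
                                     (m<m+n m (countTop-positive m β k 1≤k βk≡)))

  occursUpTo-beyond : ∀ {r c} → n < r → 1 ≤ c → c < w r → OccursUpTo w r c
  occursUpTo-beyond {r} {c} n<r 1≤c c<wr with w-surjective c 1≤c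
  ... | i , 1≤i , wi≡c with i ≤? r
  ...   | yes i≤r = i , 1≤i , i≤r , wi≡c
  ...   | no i≰r = ⊥-elim (<-asym c<wr (subst (w r <_) wi≡c (w-increasing n<r (≰⇒> i≰r))))

  occursUpTo-top : ∀ {r c} → 1 ≤ r → r ≤ n → β r ≡ suc m → m < c → c < w r →
    OccursUpTo w r c
  occursUpTo-top {r} {c} 1≤r r≤n βr≡ m<c c<wr
    with countTop-attains m β r (c ∸ m) (m<n⇒0<n∸m m<c) (<⇒≤ c∸m<ct)
    where
    c∸m<ct : c ∸ m < countTop m β r
    c∸m<ct = subst (c ∸ m <_) (m+n∸m≡n m _)
      (∸-monoˡ-< (subst (c <_) (w-top r 1≤r r≤n βr≡) c<wr) (<⇒≤ m<c))
  ... | i , 1≤i , i≤r , βi≡ , cti≡ = i , 1≤i , i≤r , (begin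
    w i                  ≡⟨ w-top i 1≤i (≤-trans i≤r r≤n) βi≡ ⟩
    m + countTop m β i   ≡⟨ cong (m +_) cti≡ ⟩
    m + (c ∸ m)          ≡⟨ m+[n∸m]≡n (<⇒≤ m<c) ⟩
    c                    ∎)
    where open ≡-Reasoning

  rd⊆box : ∀ r c → RD w r c → Box n m r c
  rd⊆box r c rd@(1≤r , 1≤c , c<wr , _) = (1≤r , r≤n) , (1≤c , c≤m)
    where
    r≤n : r ≤ n
    r≤n with r ≤? n
    ... | yes r≤n = r≤n
    ... | no r≰n = ⊥-elim (RD⇒¬OccursUpTo rd (occursUpTo-beyond (≰⇒> r≰n) 1≤c c<wr))
    c≤m : c ≤ m
    c≤m with c ≤? m | w-row r 1≤r r≤n
    ... | yes c≤m | _ = c≤m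
    ... | no _ | inj₂ (βr≤m , wr≡βr) = <⇒≤ (<-≤-trans c<wr (subst (_≤ m) (sym wr≡βr) βr≤m))
    ... | no c≰m | inj₁ (βr≡ , _) =
      ⊥-elim (RD⇒¬OccursUpTo rd (occursUpTo-top 1≤r r≤n βr≡ (≰⇒> c≰m) c<wr))

  snow⊆box : ∀ r c → snow α r c → Box n m r c
  snow⊆box r c (1≤r , inj₁ (_ , 1≤c , c≤αr)) =
    (1≤r , supp r 1≤r (≤-trans 1≤c c≤αr)) , (1≤c , ≤-trans c≤αr (max r 1≤r))
  snow⊆box r c (1≤r , inj₂ (j , r<j , 0<αj , refl)) =
    (1≤r , <⇒≤ (<-≤-trans r<j (supp j 1≤j 0<αj))) , (0<αj , max j 1≤j)
    where
    1≤j = ≤-trans 1≤r (<⇒≤ r<j)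

  module Cell {r c : ℕ} (1≤r : 1 ≤ r) (r≤n : r ≤ n) (1≤c : 1 ≤ c) (c≤m : c ≤ m) where

    r' c' : ℕ
    r' = suc n ∸ r
    c' = suc m ∸ c

    below⇔ : c' < w r' ⇔ α r < c
    below⇔ with w-row r' (reflect-positive r≤n) (reflect-≤ 1≤r)
    ... | inj₁ (βr'≡ , 1+m≤wr') =
      mk⇔ (λ _ → subst (_< c) (sym αr≡0) 1≤c)
          (λ _ → <-≤-trans (s≤s (reflect-≤ 1≤c)) 1+m≤wr')
      where
      αr≡0 : α r ≡ 0
      αr≡0 = ∸-cancelˡ-≡ (m≤n⇒m≤1+n (max r 1≤r)) z≤n (trans (sym (β-reflect r≤n)) βr'≡)
    ... | inj₂ (_ , wr'≡βr') =
      subst (λ x → c' < x ⇔ α r < c) (sym (trans wr'≡βr' (β-reflect r≤n)))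
            (k∸c<k∸a⇔a<c (m≤n⇒m≤1+n c≤m))

    occursUpTo⇒occursFrom : OccursUpTo w r' c' → OccursFrom α r c
    occursUpTo⇒occursFrom (i , 1≤i , i≤r' , wi≡c')
      with w-row i 1≤i (≤-trans i≤r' (reflect-≤ 1≤r))
    ... | inj₁ (_ , 1+m≤wi) =
      ⊥-elim (≤⇒≯ (reflect-≤ 1≤c) (subst (suc m ≤_) wi≡c' 1+m≤wi))
    ... | inj₂ (_ , wi≡βi) = suc n ∸ i , reflect-antitone r≤n i≤r' ,
      ∸-cancelˡ-≡ (m≤n⇒m≤1+n (max _ (reflect-positive (≤-trans i≤r' (reflect-≤ 1≤r)))))
                  (m≤n⇒m≤1+n c≤m) (trans (sym wi≡βi) wi≡c')

    occursFrom⇒occursUpTo : OccursFrom α r c → OccursUpTo w r' c'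
    occursFrom⇒occursUpTo (j , r≤j , αj≡c) =
      suc n ∸ j , reflect-positive j≤n , ∸-monoʳ-≤ (suc n) r≤j , trans wi≡βi βi≡c'
      where
      1≤j = ≤-trans 1≤r r≤j
      j≤n = supp j 1≤j (subst (0 <_) (sym αj≡c) 1≤c)
      βi≡c' : β (suc n ∸ j) ≡ c'
      βi≡c' = trans (β-reflect j≤n) (cong (suc m ∸_) αj≡c)
      wi≡βi : w (suc n ∸ j) ≡ β (suc n ∸ j)
      wi≡βi = w-low _ (reflect-positive j≤n) (reflect-≤ 1≤j)
                    (subst (_≤ m) (sym βi≡c') (reflect-≤ 1≤c))

    snow⇒¬RD : snow α r c → ¬ RD w r' c'
    snow⇒¬RD (_ , inj₁ (_ , _ , c≤αr)) (_ , _ , c'<wr' , _) =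
      ≤⇒≯ c≤αr (Equivalence.to below⇔ c'<wr')
    snow⇒¬RD (_ , inj₂ (j , r<j , _ , c≡αj)) rd =
      RD⇒¬OccursUpTo rd (occursFrom⇒occursUpTo (j , <⇒≤ r<j , sym c≡αj))

    ¬RD⇒snow : ¬ RD w r' c' → snow α r c
    ¬RD⇒snow ¬rd with c ≤? α r
    ... | yes c≤αr = 1≤r , inj₁ (1≤r , 1≤c , c≤αr)
    ... | no c≰αr with anyUpTo? (λ j → (r <? j) ×-dec (α j ≟ c)) (suc n)
    ...   | yes (j , _ , r<j , αj≡c) =
      1≤r , inj₂ (j , r<j , subst (0 <_) (sym αj≡c) 1≤c , sym αj≡c)
    ...   | no noLaterRow = ⊥-elim (¬rd (reflect-positive r≤n , reflect-positive c≤m ,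
                                        Equivalence.from below⇔ αr<c , avoids))
      where
      αr<c = ≰⇒> c≰αr
      avoids : ∀ i → 1 ≤ i → i ≤ r' → ¬ (w i ≡ c')
      avoids i 1≤i i≤r' wi≡c' with occursUpTo⇒occursFrom (i , 1≤i , i≤r' , wi≡c')
      ... | j , r≤j , αj≡c with m≤n⇒m<n∨m≡n r≤j
      ...   | inj₂ refl = <-irrefl αj≡c αr<c
      ...   | inj₁ r<j = noLaterRow
        (j , s≤s (supp j (≤-trans 1≤r r≤j) (subst (0 <_) (sym αj≡c) 1≤c)) , r<j , αj≡c)

  snow⇔box×¬rotatedRD : ∀ r c → snow α r c ⇔ (Box n m r c × ¬ RD w (suc n ∸ r) (suc m ∸ c))
  snow⇔box×¬rotatedRD r c = mk⇔
    (λ s → let box@((1≤r , r≤n) , 1≤c , c≤m) = snow⊆box r c s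
           in box , Cell.snow⇒¬RD 1≤r r≤n 1≤c c≤m s)
    (λ { (((1≤r , r≤n) , 1≤c , c≤m) , ¬rd) → Cell.¬RD⇒snow 1≤r r≤n 1≤c c≤m ¬rd })

lemma3p10 : (α : WeakComp) (n m : ℕ) (w : ℕ → ℕ) →
    Snowy α → SuppIn α n → MaxLe α m → IsStd m n α w →
    (∀ r c → snow α r c → Box n m r c) ×
    (∀ r c → RD w r c → Box n m r c) ×
    (∀ r c → snow α r c ⇔ (Box n m r c × ¬ RD w (suc n ∸ r) (suc m ∸ c)))
lemma3p10 α n m w _ supp max std = snow⊆box , rd⊆box , snow⇔box×¬rotatedRD
  where open Standardization α n m w supp max std
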